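{- Let $\langle A,f,g\rangle$ be a PS-algebra and define $d:A\to A$ by $d(a)=f(a,a)+-g(a,a)$. Then $d$ is the unary discriminator on $A$ (i.e., $d(0)=0$ and $d(a)=1$ for all $a\neq 0$) if and only if for all $a,b\in A$, $a\cdot b\neq 0\rightarrow g(a,b)\le f(a,b)$.
   Context: $A$ is a non-trivial Boolean algebra ($+,\cdot,-,0,1$). A PS-algebra $\langle A,f,g\rangle$ has $f:A^2\to A$ with $f(0,y)=f(x,0)=0$ and additive in each argument, and $g:A^2\to A$ with $g(0,y)=g(x,0)=1$, $g(x+x',y)=g(x,y)\cdot g(x',y)$ and $g(x,y+y')=g(x,y)\cdot g(x,y')$. -}

module Defs where

open import Level using (Level; _⊔_)
open import Relation.Nullary using (¬_)
open import Algebra.Core using (Op₁; Op₂)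
open import Algebra.Lattice.Bundles using (BooleanAlgebra)

module _ {c ℓ : Level} (B : BooleanAlgebra c ℓ) where
  open BooleanAlgebra B renaming (Carrier to A; _∨_ to _+_; _∧_ to _·_; ¬_ to -_; ⊤ to 𝟙; ⊥ to 𝟘)

  _≤B_ : A → A → Set ℓ
  a ≤B b = (a · b) ≈ a

  NonTrivial : Set ℓ
  NonTrivial = ¬ (𝟙 ≈ 𝟘)

  -- PS-algebra operations on the Boolean algebra B
  -- (congruence w.r.t. the setoid equality is required since equality is a setoid)
  record IsPS (f g : Op₂ A) : Set (c ⊔ ℓ) where
    field
      f-cong : ∀ {x x' y y'} → x ≈ x' → y ≈ y' → f x y ≈ f x' y'
      f-0ˡ   : ∀ y → f 𝟘 y ≈ 𝟘
      f-0ʳ   : ∀ x → f x 𝟘 ≈ 𝟘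
      f-addˡ : ∀ x x' y → f (x + x') y ≈ (f x y + f x' y)
      f-addʳ : ∀ x y y' → f x (y + y') ≈ (f x y + f x y')
      g-cong : ∀ {x x' y y'} → x ≈ x' → y ≈ y' → g x y ≈ g x' y'
      g-0ˡ   : ∀ y → g 𝟘 y ≈ 𝟙
      g-0ʳ   : ∀ x → g x 𝟘 ≈ 𝟙
      g-mulˡ : ∀ x x' y → g (x + x') y ≈ (g x y · g x' y)
      g-mulʳ : ∀ x y y' → g x (y + y') ≈ (g x y · g x y')

  dOp : Op₂ A → Op₂ A → Op₁ A
  dOp f g a = f a a + (- g a a)

  IsUnaryDiscriminator : Op₁ A → Set (c ⊔ ℓ)
  IsUnaryDiscriminator d = (d 𝟘 ≈ 𝟘) × (∀ a → ¬ (a ≈ 𝟘) → d a ≈ 𝟙)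
    where open import Data.Product using (_×_)

{-# OPTIONS --safe #-}
module Submission where

-- Additivity makes f monotone and multiplicativity makes g antitone in each
-- argument, so with c = a · b we get g(a,b) ≤ g(c,c) and f(c,c) ≤ f(a,b):
-- the condition g ≤ f on pairs with a · b ≠ 0 reduces to the diagonal. On the
-- diagonal, d(a) = f(a,a) + -g(a,a) is 1 exactly when g(a,a) ≤ f(a,a), while
-- d(0) = 0 holds in every PS-algebra.

open import Defs
open import Level using (Level)
open import Relation.Nullary using (¬_)
open import Function.Base using (_∘_)
open import Function.Bundles using (_⇔_; mk⇔; module Equivalence)
open import Algebra.Core using (Op₂)
open import Algebra.Lattice.Bundles using (BooleanAlgebra)
open import Data.Product using (_,_)
import Algebra.Lattice.Properties.BooleanAlgebra as BooleanAlgebraProperties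
import Relation.Binary.Lattice.Bundles as OrderTheoretic
import Relation.Binary.Lattice.Properties.JoinSemilattice as JoinSemilatticeProperties
import Relation.Binary.Reasoning.Setoid as SetoidReasoning
import Relation.Binary.Reasoning.PartialOrder as PosetReasoning

open Equivalence using (to; from)

module BooleanOrder {c ℓ : Level} (B : BooleanAlgebra c ℓ) where
  open BooleanAlgebra B renaming (¬_ to -_) public
  open BooleanAlgebraProperties B
  open OrderTheoretic.Lattice ∨-∧-orderTheoreticLattice public
    using (_≤_; poset; x≤x∨y; x∧y≤x; x∧y≤y; ≤-respˡ-≈; ≤-respʳ-≈)
  open JoinSemilatticeProperties
    (OrderTheoretic.Lattice.joinSemilattice ∨-∧-orderTheoreticLattice) public
    using (x≤y⇒x∨y≈y)
  open SetoidReasoning setoid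

  ≤ᴮ⇔≤ : ∀ {x y} → _≤B_ B x y ⇔ x ≤ y
  ≤ᴮ⇔≤ = mk⇔ sym sym

  ≤⇔∨-≈⊤ : ∀ {x y} → x ≤ y ⇔ (y ∨ - x) ≈ ⊤
  ≤⇔∨-≈⊤ {x} {y} = mk⇔ ≤⇒∨-≈⊤ ∨-≈⊤⇒≤
    where
    ≤⇒∨-≈⊤ : x ≤ y → (y ∨ - x) ≈ ⊤
    ≤⇒∨-≈⊤ x≤y = begin
      y ∨ - x                 ≈⟨ ∨-comm y (- x) ⟩
      - x ∨ y                 ≈⟨ ∧-identityˡ _ ⟨
      ⊤ ∧ (- x ∨ y)           ≈⟨ ∧-congʳ (∨-complementˡ x) ⟨
      (- x ∨ x) ∧ (- x ∨ y)   ≈⟨ ∨-distribˡ-∧ (- x) x y ⟨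
      - x ∨ (x ∧ y)           ≈⟨ ∨-congˡ x≤y ⟨
      - x ∨ x                 ≈⟨ ∨-complementˡ x ⟩
      ⊤                       ∎

    ∨-≈⊤⇒≤ : (y ∨ - x) ≈ ⊤ → x ≤ y
    ∨-≈⊤⇒≤ y∨-x≈⊤ = sym (begin
      x ∧ y                   ≈⟨ ∨-identityʳ _ ⟨
      (x ∧ y) ∨ ⊥             ≈⟨ ∨-congˡ (∧-complementʳ x) ⟨
      (x ∧ y) ∨ (x ∧ - x)     ≈⟨ ∧-distribˡ-∨ x y (- x) ⟨
      x ∧ (y ∨ - x)           ≈⟨ ∧-congˡ y∨-x≈⊤ ⟩
      x ∧ ⊤                   ≈⟨ ∧-identityʳ x ⟩
      x                       ∎)

module PSAlgebra {c ℓ : Level} (B : BooleanAlgebra c ℓ)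
                 {f g : Op₂ (BooleanAlgebra.Carrier B)} (ps : IsPS B f g) where
  open BooleanOrder B
  open BooleanAlgebraProperties B using (∨-identityʳ; ¬⊤≈⊥)
  open IsPS ps

  d-⊥ : dOp B f g ⊥ ≈ ⊥
  d-⊥ = begin
    f ⊥ ⊥ ∨ - g ⊥ ⊥   ≈⟨ ∨-cong (f-0ˡ ⊥) (¬-cong (g-0ˡ ⊥)) ⟩
    ⊥ ∨ - ⊤           ≈⟨ ∨-congˡ ¬⊤≈⊥ ⟩
    ⊥ ∨ ⊥             ≈⟨ ∨-identityʳ ⊥ ⟩
    ⊥                 ∎
    where open SetoidReasoning setoid

  f-monoˡ : ∀ {x x'} y → x ≤ x' → f x y ≤ f x' y
  f-monoˡ {x} {x'} y x≤x' =
    ≤-respʳ-≈ (trans (sym (f-addˡ x x' y)) (f-cong (x≤y⇒x∨y≈y x≤x') refl)) (x≤x∨y _ _)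

  f-monoʳ : ∀ x {y y'} → y ≤ y' → f x y ≤ f x y'
  f-monoʳ x {y} {y'} y≤y' =
    ≤-respʳ-≈ (trans (sym (f-addʳ x y y')) (f-cong refl (x≤y⇒x∨y≈y y≤y'))) (x≤x∨y _ _)

  g-antiˡ : ∀ {x x'} y → x ≤ x' → g x' y ≤ g x y
  g-antiˡ {x} {x'} y x≤x' =
    ≤-respˡ-≈ (trans (sym (g-mulˡ x x' y)) (g-cong (x≤y⇒x∨y≈y x≤x') refl)) (x∧y≤x _ _)

  g-antiʳ : ∀ x {y y'} → y ≤ y' → g x y' ≤ g x y
  g-antiʳ x {y} {y'} y≤y' =
    ≤-respˡ-≈ (trans (sym (g-mulʳ x y y')) (g-cong refl (x≤y⇒x∨y≈y y≤y'))) (x∧y≤x _ _)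

  g≤f-from-diagonal : (∀ a → ¬ (a ≈ ⊥) → g a a ≤ f a a) →
                      ∀ a b → ¬ ((a ∧ b) ≈ ⊥) → g a b ≤ f a b
  g≤f-from-diagonal diagonal a b a∧b≉⊥ = begin
    g a b              ≤⟨ g-antiˡ b (x∧y≤x a b) ⟩
    g (a ∧ b) b        ≤⟨ g-antiʳ (a ∧ b) (x∧y≤y a b) ⟩
    g (a ∧ b) (a ∧ b)  ≤⟨ diagonal (a ∧ b) a∧b≉⊥ ⟩
    f (a ∧ b) (a ∧ b)  ≤⟨ f-monoʳ (a ∧ b) (x∧y≤y a b) ⟩
    f (a ∧ b) b        ≤⟨ f-monoˡ b (x∧y≤x a b) ⟩
    f a b              ∎
    where open PosetReasoning poset

lemma6p13 : {c ℓ : Level} (B : BooleanAlgebra c ℓ) → NonTrivial B →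
            (f g : Op₂ (BooleanAlgebra.Carrier B)) → IsPS B f g →
            IsUnaryDiscriminator B (dOp B f g)
              ⇔ (∀ a b → ¬ (BooleanAlgebra._≈_ B (BooleanAlgebra._∧_ B a b) (BooleanAlgebra.⊥ B)) →
                   _≤B_ B (g a b) (f a b))
lemma6p13 B _ f g ps = mk⇔ discriminator⇒g≤f g≤f⇒discriminator
  where
  open BooleanOrder B
  open PSAlgebra B ps
  open BooleanAlgebraProperties B using (∧-idem)

  discriminator⇒g≤f : IsUnaryDiscriminator B (dOp B f g) →
                      ∀ a b → ¬ ((a ∧ b) ≈ ⊥) → _≤B_ B (g a b) (f a b)
  discriminator⇒g≤f (_ , d≈⊤) a b a∧b≉⊥ =
    from ≤ᴮ⇔≤ (g≤f-from-diagonal (λ x x≉⊥ → from ≤⇔∨-≈⊤ (d≈⊤ x x≉⊥)) a b a∧b≉⊥)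

  g≤f⇒discriminator : (∀ a b → ¬ ((a ∧ b) ≈ ⊥) → _≤B_ B (g a b) (f a b)) →
                      IsUnaryDiscriminator B (dOp B f g)
  g≤f⇒discriminator g≤f = d-⊥ , λ a a≉⊥ →
    to ≤⇔∨-≈⊤ (to ≤ᴮ⇔≤ (g≤f a a (a≉⊥ ∘ trans (sym (∧-idem a)))))
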